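{- For all integers $n\ge0$ and $r\ge1$, \[ h_{n}^{(r)}=\sum_{k=0}^{n}(-1)^{k+1}\binom{n+r}{k+r}H_{k}. \]
   Context: $H_k=1+\frac12+\cdots+\frac1k$ (with $H_0=0$) are the harmonic numbers. The hyperharmonic numbers are defined by $h_n^{(r)}=\sum_{k=1}^n h_k^{(r-1)}$ for $r\ge1$, with $h_k^{(0)}=1/k$ and $h_0^{(r)}=0$; equivalently $\sum_{n\ge0}h_n^{(r)}t^n=\frac{ -\ln(1-t)}{(1-t)^r}$. -}

module Defs where

open import Data.Nat as ℕ using (ℕ; zero; suc)
open import Data.Nat.Combinatorics using (_C_)
open import Data.Integer as ℤ using (ℤ; +_)
open import Data.Rational using (ℚ; 0ℚ; _+_; _*_; -_; _/_)

-- 1/k as a rational, for k ≥ 1 (written with suc to avoid NonZero side conditions)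
recip : ℕ → ℚ
recip k = + 1 / suc k

H : ℕ → ℚ
H zero    = 0ℚ
H (suc k) = H k + recip k

-- Hyperharmonic numbers h n r = h_n^{(r)}:
--   h_0^{(r)} = 0, h_k^{(0)} = 1/k (k ≥ 1), h_n^{(r)} = Σ_{k=1}^n h_k^{(r-1)} (r ≥ 1)
hyp : ℕ → ℕ → ℚ
hyp zero    r       = 0ℚ
hyp (suc k) zero    = recip k
hyp (suc n) (suc r) = hyp n (suc r) + hyp (suc n) r

fromℕ : ℕ → ℚ
fromℕ m = + m / 1

sgn : ℕ → ℚ
sgn zero    = + 1 / 1
sgn (suc m) = - sgn m

sumTo : ℕ → (ℕ → ℚ) → ℚ
sumTo zero    f = f 0
sumTo (suc n) f = sumTo n f + f (suc n)

-- Both sides satisfy the recursion h_{n+1}^{(r+1)} = h_n^{(r+1)} + h_{n+1}^{(r)}: on the right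
-- this is Pascal's rule for C(n+r+2, k+r+1), the extra term k = n+1 vanishing. So it remains
-- to check h_0^{(r)} = 0 and the column r = 0, i.e. Σ_k (-1)^{k+1} C(n+1,k) H_k = 1/(n+1).
-- Pascal's rule turns Σ_k C(n+1,k) a_k into Σ_k C(n,k) (a_k + a_{k+1}); for a_k = (-1)^{k+1} H_k
-- this telescopes to Σ_k C(n,k) (-1)^k/(k+1), which absorption C(n,k)/(k+1) = C(n+1,k+1)/(n+1)
-- reduces to the vanishing alternating sum of the C(n+1,k).
module Submission where

open import Defs
open import Data.Nat using (ℕ; suc; _≤_) renaming (_+_ to _+ℕ_)
open import Data.Nat.Combinatorics using (_C_)
open import Data.Rational using (ℚ; _*_)
open import Relation.Binary.PropositionalEquality using (_≡_)

open import Data.Nat using (zero) renaming (_*_ to _*ℕ_)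
import Data.Nat.Properties as ℕ
open import Data.Nat.Combinatorics using (nC1≡n; k>n⇒nCk≡0; nCk+nC[k+1]≡[n+1]C[k+1])
import Data.Integer as ℤ
import Data.Integer.Properties as ℤ
open import Data.Rational using (0ℚ; 1ℚ; _+_; -_; fromℚᵘ)
open import Data.Rational.Properties
import Data.Rational.Unnormalised as ℚᵘ
import Data.Rational.Unnormalised.Properties as ℚᵘ
open import Relation.Binary.PropositionalEquality using (refl; sym; trans; cong; cong₂; module ≡-Reasoning)
import Data.Nat.Solver as ℕ-Solver
open import Data.Rational.Solver using (module +-*-Solver)
open import Algebra.Properties.Group +-0-group using (x∙y⁻¹≈ε⇒x≈y)

fromℚᵘ-homo-+ : ∀ p q → fromℚᵘ (p ℚᵘ.+ q) ≡ fromℚᵘ p + fromℚᵘ q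
fromℚᵘ-homo-+ p q = toℚᵘ-injective (ℚᵘ.≃-trans (toℚᵘ-fromℚᵘ (p ℚᵘ.+ q))
  (ℚᵘ.≃-trans (ℚᵘ.+-cong (ℚᵘ.≃-sym (toℚᵘ-fromℚᵘ p)) (ℚᵘ.≃-sym (toℚᵘ-fromℚᵘ q)))
    (ℚᵘ.≃-sym (toℚᵘ-homo-+ (fromℚᵘ p) (fromℚᵘ q)))))

fromℚᵘ-homo-* : ∀ p q → fromℚᵘ (p ℚᵘ.* q) ≡ fromℚᵘ p * fromℚᵘ q
fromℚᵘ-homo-* p q = toℚᵘ-injective (ℚᵘ.≃-trans (toℚᵘ-fromℚᵘ (p ℚᵘ.* q))
  (ℚᵘ.≃-trans (ℚᵘ.*-cong (ℚᵘ.≃-sym (toℚᵘ-fromℚᵘ p)) (ℚᵘ.≃-sym (toℚᵘ-fromℚᵘ q)))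
    (ℚᵘ.≃-sym (toℚᵘ-homo-* (fromℚᵘ p) (fromℚᵘ q)))))

-- fromℕ m is definitionally fromℚᵘ (natᵘ m), so the casts are computed in ℚᵘ.
natᵘ : ℕ → ℚᵘ.ℚᵘ
natᵘ m = ℚᵘ.mkℚᵘ (ℤ.+ m) 0

natᵘ-homo-+ : ∀ a b → natᵘ (a +ℕ b) ℚᵘ.≃ natᵘ a ℚᵘ.+ natᵘ b
natᵘ-homo-+ a b = ℚᵘ.*≡* (cong (ℤ._* ℤ.+ 1) (trans (ℤ.pos-+ a b)
  (sym (cong₂ ℤ._+_ (ℤ.*-identityʳ (ℤ.+ a)) (ℤ.*-identityʳ (ℤ.+ b))))))

natᵘ-homo-* : ∀ a b → natᵘ (a *ℕ b) ℚᵘ.≃ natᵘ a ℚᵘ.* natᵘ b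
natᵘ-homo-* a b = ℚᵘ.*≡* (cong (ℤ._* ℤ.+ 1) (ℤ.pos-* a b))

fromℕ-homo-+ : ∀ a b → fromℕ (a +ℕ b) ≡ fromℕ a + fromℕ b
fromℕ-homo-+ a b = trans (fromℚᵘ-cong (natᵘ-homo-+ a b)) (fromℚᵘ-homo-+ (natᵘ a) (natᵘ b))

fromℕ-homo-* : ∀ a b → fromℕ (a *ℕ b) ≡ fromℕ a * fromℕ b
fromℕ-homo-* a b = trans (fromℚᵘ-cong (natᵘ-homo-* a b)) (fromℚᵘ-homo-* (natᵘ a) (natᵘ b))

natᵘ-suc*recipᵘ : ∀ j → natᵘ (suc j) ℚᵘ.* ℚᵘ.mkℚᵘ (ℤ.+ 1) j ℚᵘ.≃ ℚᵘ.1ℚᵘ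
natᵘ-suc*recipᵘ j = ℚᵘ.*≡* (cong ℤ.+_
  (solve 1 (λ x → (con 1 :+ x) :* con 1 :* con 1 := con 1 :* (con 1 :* (con 1 :+ x))) refl j))
  where open ℕ-Solver.+-*-Solver

fromℕ-suc*recip : ∀ j → fromℕ (suc j) * recip j ≡ 1ℚ
fromℕ-suc*recip j = trans (sym (fromℚᵘ-homo-* (natᵘ (suc j)) (ℚᵘ.mkℚᵘ (ℤ.+ 1) j))) (fromℚᵘ-cong (natᵘ-suc*recipᵘ j))

recip-unique : ∀ n x → fromℕ (suc n) * x ≡ 1ℚ → x ≡ recip n
recip-unique n x [n+1]x≡1 = begin
  x                                  ≡⟨ sym (*-identityˡ x) ⟩
  1ℚ * x                             ≡⟨ cong (_* x) (sym (trans (*-comm (recip n) _) (fromℕ-suc*recip n))) ⟩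
  recip n * fromℕ (suc n) * x        ≡⟨ *-assoc (recip n) _ x ⟩
  recip n * (fromℕ (suc n) * x)      ≡⟨ cong (recip n *_) [n+1]x≡1 ⟩
  recip n * 1ℚ                       ≡⟨ *-identityʳ (recip n) ⟩
  recip n                            ∎
  where open ≡-Reasoning

sumTo-cong : ∀ n {f g : ℕ → ℚ} → (∀ k → f k ≡ g k) → sumTo n f ≡ sumTo n g
sumTo-cong zero    f≡g = f≡g 0
sumTo-cong (suc n) f≡g = cong₂ _+_ (sumTo-cong n f≡g) (f≡g (suc n))

sumTo-zero : ∀ n → sumTo n (λ _ → 0ℚ) ≡ 0ℚ
sumTo-zero zero    = refl
sumTo-zero (suc n) = cong (_+ 0ℚ) (sumTo-zero n)

sumTo-distrib-+ : ∀ n (f g : ℕ → ℚ) → sumTo n (λ k → f k + g k) ≡ sumTo n f + sumTo n g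
sumTo-distrib-+ zero    f g = refl
sumTo-distrib-+ (suc n) f g = trans (cong (_+ (f (suc n) + g (suc n))) (sumTo-distrib-+ n f g))
  (solve 4 (λ a b c d → (a :+ b) :+ (c :+ d) := (a :+ c) :+ (b :+ d)) refl
    (sumTo n f) (sumTo n g) (f (suc n)) (g (suc n)))
  where open +-*-Solver

sumTo-neg : ∀ n (f : ℕ → ℚ) → sumTo n (λ k → - f k) ≡ - sumTo n f
sumTo-neg zero    f = refl
sumTo-neg (suc n) f = trans (cong (_+ (- f (suc n))) (sumTo-neg n f))
  (sym (neg-distrib-+ (sumTo n f) (f (suc n))))

*-distribˡ-sumTo : ∀ n c (f : ℕ → ℚ) → c * sumTo n f ≡ sumTo n (λ k → c * f k)
*-distribˡ-sumTo zero    c f = refl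
*-distribˡ-sumTo (suc n) c f = trans (*-distribˡ-+ c (sumTo n f) (f (suc n)))
  (cong (_+ (c * f (suc n))) (*-distribˡ-sumTo n c f))

sumTo-suc : ∀ n (f : ℕ → ℚ) → sumTo (suc n) f ≡ f 0 + sumTo n (λ k → f (suc k))
sumTo-suc zero    f = refl
sumTo-suc (suc n) f = trans (cong (_+ f (suc (suc n))) (sumTo-suc n f)) (+-assoc (f 0) _ _)

sumTo-suc-vanishing : ∀ n (f : ℕ → ℚ) → f (suc n) ≡ 0ℚ → sumTo (suc n) f ≡ sumTo n f
sumTo-suc-vanishing n f f[1+n]≡0 = trans (cong (sumTo n f +_) f[1+n]≡0) (+-identityʳ (sumTo n f))

[1+k]*[1+n]C[1+k]≡[1+n]*nCk : ∀ n k → suc k *ℕ (suc n C suc k) ≡ suc n *ℕ (n C k)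
[1+k]*[1+n]C[1+k]≡[1+n]*nCk zero    zero    = refl
[1+k]*[1+n]C[1+k]≡[1+n]*nCk zero    (suc k) = ℕ.*-zeroʳ (suc (suc k))
[1+k]*[1+n]C[1+k]≡[1+n]*nCk (suc n) zero    =
  trans (ℕ.*-identityˡ _) (trans (nC1≡n (suc (suc n))) (sym (ℕ.*-identityʳ (suc (suc n)))))
[1+k]*[1+n]C[1+k]≡[1+n]*nCk (suc n) (suc k) = begin
  suc (suc k) *ℕ (suc (suc n) C suc (suc k))
    ≡⟨ cong (suc (suc k) *ℕ_) (sym (nCk+nC[k+1]≡[n+1]C[k+1] (suc n) (suc k))) ⟩
  suc (suc k) *ℕ (x +ℕ y)
    ≡⟨ solve 3 (λ k x y → (con 2 :+ k) :* (x :+ y) := x :+ ((con 1 :+ k) :* x :+ (con 2 :+ k) :* y)) refl k x y ⟩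
  x +ℕ (suc k *ℕ x +ℕ suc (suc k) *ℕ y)
    ≡⟨ cong (x +ℕ_) (cong₂ _+ℕ_ ([1+k]*[1+n]C[1+k]≡[1+n]*nCk n k) ([1+k]*[1+n]C[1+k]≡[1+n]*nCk n (suc k))) ⟩
  x +ℕ (suc n *ℕ (n C k) +ℕ suc n *ℕ (n C suc k))
    ≡⟨ cong (x +ℕ_) (trans (sym (ℕ.*-distribˡ-+ (suc n) (n C k) _)) (cong (suc n *ℕ_) (nCk+nC[k+1]≡[n+1]C[k+1] n k))) ⟩
  x +ℕ suc n *ℕ x
    ∎
  where
  open ≡-Reasoning
  open ℕ-Solver.+-*-Solver
  x = suc n C suc k
  y = suc n C suc (suc k)

[1+n]*nCk/[1+k]≡[1+n]C[1+k] : ∀ n k → fromℕ (suc n) * (fromℕ (n C k) * recip k) ≡ fromℕ (suc n C suc k)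
[1+n]*nCk/[1+k]≡[1+n]C[1+k] n k = begin
  fromℕ (suc n) * (fromℕ (n C k) * recip k)         ≡⟨ sym (*-assoc (fromℕ (suc n)) _ _) ⟩
  fromℕ (suc n) * fromℕ (n C k) * recip k           ≡⟨ cong (_* recip k) (sym (fromℕ-homo-* (suc n) (n C k))) ⟩
  fromℕ (suc n *ℕ (n C k)) * recip k                ≡⟨ cong (λ m → fromℕ m * recip k) (sym ([1+k]*[1+n]C[1+k]≡[1+n]*nCk n k)) ⟩
  fromℕ (suc k *ℕ (suc n C suc k)) * recip k        ≡⟨ cong (_* recip k) (fromℕ-homo-* (suc k) (suc n C suc k)) ⟩
  fromℕ (suc k) * fromℕ (suc n C suc k) * recip k   ≡⟨ solve 3 (λ K c r → K :* c :* r := c :* (K :* r)) refl (fromℕ (suc k)) _ (recip k) ⟩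
  fromℕ (suc n C suc k) * (fromℕ (suc k) * recip k) ≡⟨ cong (fromℕ (suc n C suc k) *_) (fromℕ-suc*recip k) ⟩
  fromℕ (suc n C suc k) * 1ℚ                        ≡⟨ *-identityʳ _ ⟩
  fromℕ (suc n C suc k)                             ∎
  where
  open ≡-Reasoning
  open +-*-Solver

binomialSum : ℕ → (ℕ → ℚ) → ℚ
binomialSum n a = sumTo n (λ k → fromℕ (n C k) * a k)

binomialSum-cong : ∀ n {a b : ℕ → ℚ} → (∀ k → a k ≡ b k) → binomialSum n a ≡ binomialSum n b
binomialSum-cong n a≡b = sumTo-cong n (λ k → cong (fromℕ (n C k) *_) (a≡b k))

binomialSum-suc : ∀ n (a : ℕ → ℚ) → binomialSum (suc n) a ≡ binomialSum n (λ k → a k + a (suc k))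
binomialSum-suc n a = begin
  binomialSum (suc n) a
    ≡⟨ sumTo-suc n _ ⟩
  c₀ + sumTo n (λ j → fromℕ (suc n C suc j) * a (suc j))
    ≡⟨ cong (λ z → c₀ + z) (trans (sumTo-cong n pascal) (sumTo-distrib-+ n _ _)) ⟩
  c₀ + (binomialSum n (λ k → a (suc k)) + sumTo n (λ j → fromℕ (n C suc j) * a (suc j)))
    ≡⟨ solve 3 (λ x y z → x :+ (y :+ z) := (x :+ z) :+ y) refl c₀ (binomialSum n (λ k → a (suc k))) _ ⟩
  (c₀ + sumTo n (λ j → fromℕ (n C suc j) * a (suc j))) + binomialSum n (λ k → a (suc k))
    ≡⟨ cong (_+ binomialSum n (λ k → a (suc k))) (trans (sym (sumTo-suc n _)) top-term-vanishes) ⟩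
  binomialSum n a + binomialSum n (λ k → a (suc k))
    ≡⟨ sym (trans (sumTo-cong n (λ k → *-distribˡ-+ (fromℕ (n C k)) (a k) (a (suc k)))) (sumTo-distrib-+ n _ _)) ⟩
  binomialSum n (λ k → a k + a (suc k))
    ∎
  where
  open ≡-Reasoning
  open +-*-Solver
  c₀ = fromℕ 1 * a 0
  pascal : ∀ j → fromℕ (suc n C suc j) * a (suc j) ≡ fromℕ (n C j) * a (suc j) + fromℕ (n C suc j) * a (suc j)
  pascal j = trans (cong (λ c → fromℕ c * a (suc j)) (sym (nCk+nC[k+1]≡[n+1]C[k+1] n j)))
    (trans (cong (_* a (suc j)) (fromℕ-homo-+ (n C j) (n C suc j)))
      (*-distribʳ-+ (a (suc j)) (fromℕ (n C j)) (fromℕ (n C suc j))))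
  top-term-vanishes : sumTo (suc n) (λ k → fromℕ (n C k) * a k) ≡ binomialSum n a
  top-term-vanishes = sumTo-suc-vanishing n _
    (trans (cong (λ c → fromℕ c * a (suc n)) (k>n⇒nCk≡0 (ℕ.n<1+n n))) (*-zeroˡ (a (suc n))))

binomialSum-sgn : ∀ n → binomialSum (suc n) sgn ≡ 0ℚ
binomialSum-sgn n = begin
  binomialSum (suc n) sgn                       ≡⟨ binomialSum-suc n sgn ⟩
  binomialSum n (λ k → sgn k + - sgn k)         ≡⟨ binomialSum-cong n (λ k → +-inverseʳ (sgn k)) ⟩
  sumTo n (λ k → fromℕ (n C k) * 0ℚ)            ≡⟨ sumTo-cong n (λ k → *-zeroʳ (fromℕ (n C k))) ⟩
  sumTo n (λ _ → 0ℚ)                            ≡⟨ sumTo-zero n ⟩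
  0ℚ                                            ∎
  where open ≡-Reasoning

alternatingSum-[1+n]C[1+k] : ∀ n → sumTo n (λ k → sgn k * fromℕ (suc n C suc k)) ≡ 1ℚ
alternatingSum-[1+n]C[1+k] n = sym (x∙y⁻¹≈ε⇒x≈y 1ℚ T (begin
  1ℚ + - T
    ≡⟨ cong (1ℚ +_) (sym (sumTo-neg n _)) ⟩
  1ℚ + sumTo n (λ k → - (sgn k * fromℕ (suc n C suc k)))
    ≡⟨ cong (1ℚ +_) (sumTo-cong n (λ k → trans (neg-distribˡ-* (sgn k) _) (*-comm (- sgn k) _))) ⟩
  1ℚ + sumTo n (λ k → fromℕ (suc n C suc k) * sgn (suc k))
    ≡⟨ sym (sumTo-suc n _) ⟩
  binomialSum (suc n) sgn
    ≡⟨ binomialSum-sgn n ⟩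
  0ℚ
    ∎))
  where
  open ≡-Reasoning
  T = sumTo n (λ k → sgn k * fromℕ (suc n C suc k))

binomialSum-sgn*recip : ∀ n → binomialSum n (λ k → sgn k * recip k) ≡ recip n
binomialSum-sgn*recip n = recip-unique n _ (begin
  fromℕ (suc n) * binomialSum n (λ k → sgn k * recip k)
    ≡⟨ *-distribˡ-sumTo n (fromℕ (suc n)) _ ⟩
  sumTo n (λ k → fromℕ (suc n) * (fromℕ (n C k) * (sgn k * recip k)))
    ≡⟨ sumTo-cong n absorb ⟩
  sumTo n (λ k → sgn k * fromℕ (suc n C suc k))
    ≡⟨ alternatingSum-[1+n]C[1+k] n ⟩
  1ℚ
    ∎)
  where
  open ≡-Reasoning
  open +-*-Solver
  absorb : ∀ k → fromℕ (suc n) * (fromℕ (n C k) * (sgn k * recip k)) ≡ sgn k * fromℕ (suc n C suc k)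
  absorb k = trans (solve 4 (λ N c s r → N :* (c :* (s :* r)) := s :* (N :* (c :* r))) refl
      (fromℕ (suc n)) (fromℕ (n C k)) (sgn k) (recip k))
    (cong (sgn k *_) ([1+n]*nCk/[1+k]≡[1+n]C[1+k] n k))

binomialSum-harmonic : ∀ n → binomialSum (suc n) (λ k → sgn (suc k) * H k) ≡ recip n
binomialSum-harmonic n = begin
  binomialSum (suc n) (λ k → sgn (suc k) * H k)
    ≡⟨ binomialSum-suc n _ ⟩
  binomialSum n (λ k → sgn (suc k) * H k + sgn (suc (suc k)) * H (suc k))
    ≡⟨ binomialSum-cong n telescope ⟩
  binomialSum n (λ k → sgn k * recip k)
    ≡⟨ binomialSum-sgn*recip n ⟩
  recip n
    ∎
  where
  open ≡-Reasoning
  open +-*-Solver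
  telescope : ∀ k → sgn (suc k) * H k + sgn (suc (suc k)) * H (suc k) ≡ sgn k * recip k
  telescope k = solve 3 (λ s h r → (:- s) :* h :+ (:- (:- s)) :* (h :+ r) := s :* r) refl (sgn k) (H k) (recip k)

harmonicBinomialSum : ℕ → ℕ → ℚ
harmonicBinomialSum n r = sumTo n (λ k → sgn (suc k) * (fromℕ ((n +ℕ r) C (k +ℕ r)) * H k))

harmonicBinomialSum-zero : ∀ r → harmonicBinomialSum 0 r ≡ 0ℚ
harmonicBinomialSum-zero r = trans (cong (sgn 1 *_) (*-zeroʳ (fromℕ (r C r)))) (*-zeroʳ (sgn 1))

harmonicBinomialSum-suc-zero : ∀ n → harmonicBinomialSum (suc n) 0 ≡ recip n
harmonicBinomialSum-suc-zero n = trans (sumTo-cong (suc n) reorder) (binomialSum-harmonic n)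
  where
  open +-*-Solver
  reorder : ∀ k → sgn (suc k) * (fromℕ ((suc n +ℕ 0) C (k +ℕ 0)) * H k) ≡ fromℕ (suc n C k) * (sgn (suc k) * H k)
  reorder k = trans (cong (λ m → sgn (suc k) * (fromℕ m * H k)) (cong₂ _C_ (ℕ.+-identityʳ (suc n)) (ℕ.+-identityʳ k)))
    (solve 3 (λ s c h → s :* (c :* h) := c :* (s :* h)) refl (sgn (suc k)) (fromℕ (suc n C k)) (H k))

harmonicBinomialSum-suc-suc : ∀ n r →
  harmonicBinomialSum (suc n) (suc r) ≡ harmonicBinomialSum n (suc r) + harmonicBinomialSum (suc n) r
harmonicBinomialSum-suc-suc n r = begin
  harmonicBinomialSum (suc n) (suc r)
    ≡⟨ sumTo-cong (suc n) pascal ⟩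
  sumTo (suc n) (λ k → term m (suc r) k + term (suc n +ℕ r) r k)
    ≡⟨ sumTo-distrib-+ (suc n) _ _ ⟩
  sumTo (suc n) (term m (suc r)) + harmonicBinomialSum (suc n) r
    ≡⟨ cong (_+ harmonicBinomialSum (suc n) r) (sumTo-suc-vanishing n _ top-term-vanishes) ⟩
  harmonicBinomialSum n (suc r) + harmonicBinomialSum (suc n) r
    ∎
  where
  open ≡-Reasoning
  m = n +ℕ suc r
  term : ℕ → ℕ → ℕ → ℚ
  term top s k = sgn (suc k) * (fromℕ (top C (k +ℕ s)) * H k)
  pascalℕ : ∀ k → suc m C (k +ℕ suc r) ≡ m C (k +ℕ suc r) +ℕ (suc n +ℕ r) C (k +ℕ r)
  pascalℕ k = begin
    suc m C (k +ℕ suc r)                         ≡⟨ cong (suc m C_) (ℕ.+-suc k r) ⟩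
    suc m C suc (k +ℕ r)                         ≡⟨ sym (nCk+nC[k+1]≡[n+1]C[k+1] m (k +ℕ r)) ⟩
    m C (k +ℕ r) +ℕ m C suc (k +ℕ r)             ≡⟨ ℕ.+-comm (m C (k +ℕ r)) _ ⟩
    m C suc (k +ℕ r) +ℕ m C (k +ℕ r)             ≡⟨ cong₂ _+ℕ_ (cong (m C_) (sym (ℕ.+-suc k r))) (cong (_C (k +ℕ r)) (ℕ.+-suc n r)) ⟩
    m C (k +ℕ suc r) +ℕ (suc n +ℕ r) C (k +ℕ r)  ∎
  pascal : ∀ k → term (suc m) (suc r) k ≡ term m (suc r) k + term (suc n +ℕ r) r k
  pascal k = begin
    sgn (suc k) * (fromℕ (suc m C (k +ℕ suc r)) * H k)
      ≡⟨ cong (λ c → sgn (suc k) * (c * H k)) (trans (cong fromℕ (pascalℕ k)) (fromℕ-homo-+ a b)) ⟩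
    sgn (suc k) * ((fromℕ a + fromℕ b) * H k)
      ≡⟨ cong (sgn (suc k) *_) (*-distribʳ-+ (H k) (fromℕ a) (fromℕ b)) ⟩
    sgn (suc k) * (fromℕ a * H k + fromℕ b * H k)
      ≡⟨ *-distribˡ-+ (sgn (suc k)) (fromℕ a * H k) (fromℕ b * H k) ⟩
    term m (suc r) k + term (suc n +ℕ r) r k
      ∎
    where
    a = m C (k +ℕ suc r)
    b = (suc n +ℕ r) C (k +ℕ r)
  top-term-vanishes : term m (suc r) (suc n) ≡ 0ℚ
  top-term-vanishes = trans (cong (λ c → sgn (suc (suc n)) * (fromℕ c * H (suc n))) (k>n⇒nCk≡0 (ℕ.n<1+n m)))
    (trans (cong (sgn (suc (suc n)) *_) (*-zeroˡ (H (suc n)))) (*-zeroʳ (sgn (suc (suc n)))))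

hyp≡harmonicBinomialSum : ∀ n r → hyp n r ≡ harmonicBinomialSum n r
hyp≡harmonicBinomialSum zero    r       = sym (harmonicBinomialSum-zero r)
hyp≡harmonicBinomialSum (suc n) zero    = sym (harmonicBinomialSum-suc-zero n)
hyp≡harmonicBinomialSum (suc n) (suc r) = begin
  hyp n (suc r) + hyp (suc n) r
    ≡⟨ cong₂ _+_ (hyp≡harmonicBinomialSum n (suc r)) (hyp≡harmonicBinomialSum (suc n) r) ⟩
  harmonicBinomialSum n (suc r) + harmonicBinomialSum (suc n) r
    ≡⟨ sym (harmonicBinomialSum-suc-suc n r) ⟩
  harmonicBinomialSum (suc n) (suc r)
    ∎
  where open ≡-Reasoning

-- The identity also holds for r = 0, where it reads h_n^{(0)} = 1/n.
mainTheorem4 : (n r : ℕ) → 1 ≤ r →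
    hyp n r ≡ sumTo n (λ k → sgn (suc k) * (fromℕ ((n +ℕ r) C (k +ℕ r)) * H k))
mainTheorem4 n r _ = hyp≡harmonicBinomialSum n r
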